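{- Let $k\le n$ be positive integers and let $\mathbb{F}$ be a field with at least $n+k-1$ elements. Fix distinct $\alpha_1,\dots,\alpha_{n+k-1}\in\mathbb{F}$ and let $Z_{n,k}\subseteq\mathbb{F}^n$ be the set of points $(z_1,\dots,z_n)$ such that $z_i\in\{\alpha_1,\dots,\alpha_{k+i-1}\}$ for each $1\le i\le n$, the coordinates $z_1,\dots,z_n$ are distinct, and $\{\alpha_1,\dots,\alpha_k\}\subseteq\{z_1,\dots,z_n\}$. Then $$J_{n,k}:=\langle h_k(x_1),\dots,h_k(x_1,\dots,x_n),e_n(x_1,\dots,x_n),\dots,e_{n-k+1}(x_1,\dots,x_n)\rangle\subseteq\mathbf{T}(Z_{n,k}).$$
   Context: $h_d$ is the complete homogeneous and $e_d$ the elementary symmetric polynomial. For a finite $Z\subseteq\mathbb{F}^n$, $\mathbf{I}(Z)=\{f\in\mathbb{F}[x_1,\dots,x_n]: f(\mathbf{z})=0\ \forall\mathbf{z}\in Z\}$. For nonzero $f$, $\tau(f)$ is its top-degree homogeneous component, and $\mathbf{T}(Z)=\langle\tau(f): f\in\mathbf{I}(Z)\setminus\{0\}\rangle$. -}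

module Defs where

open import Level using (Level; _⊔_; suc)
open import Algebra.Bundles using (CommutativeRing)
open import Data.Nat as ℕ using (ℕ; zero; _∸_; _<_)
import Data.Nat.Properties as ℕP
open import Data.Fin using (Fin; toℕ)
open import Data.Vec using (Vec; []; _∷_; zipWith; replicate; lookup)
import Data.Vec as Vec
open import Data.Vec.Properties using (≡-dec)
open import Data.List using (List; []; _∷_; _++_; map; concatMap; upTo; foldr)
open import Data.Product using (Σ; ∃; _×_; _,_)
open import Data.Sum using (_⊎_)
open import Relation.Nullary using (¬_; yes; no)
open import Relation.Binary.PropositionalEquality using (_≡_)
open import Data.List.Relation.Unary.All using (All)

record Field (c ℓ : Level) : Set (Level.suc (c ⊔ ℓ)) where
  field
    commutativeRing : CommutativeRing c ℓ
  open CommutativeRing commutativeRing public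
  field
    0≉1     : ¬ (0# ≈ 1#)
    inverse : ∀ x → ¬ (x ≈ 0#) → Σ Carrier λ y → x * y ≈ 1#

module PolyDefs {c ℓ} (F : Field c ℓ) where
  open Field F using (Carrier; _≈_; _+_; _*_; 0#; 1#)

  -- exponent vectors of monomials in x₁,…,xₙ
  Mono : ℕ → Set
  Mono n = Vec ℕ n

  mdeg : ∀ {n} → Mono n → ℕ
  mdeg = Vec.sum

  -- polynomials in n variables as finite formal sums of terms c·x^m
  Poly : ℕ → Set c
  Poly n = List (Carrier × Mono n)

  coeff : ∀ {n} → Poly n → Mono n → Carrier
  coeff [] m = 0#
  coeff ((a , m′) ∷ p) m with ≡-dec ℕP._≟_ m′ m
  ... | yes _ = a + coeff p m
  ... | no  _ = coeff p m

  _≈P_ : ∀ {n} → Poly n → Poly n → Set ℓ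
  p ≈P q = ∀ m → coeff p m ≈ coeff q m

  NonZeroP : ∀ {n} → Poly n → Set ℓ
  NonZeroP p = ∃ λ m → ¬ (coeff p m ≈ 0#)

  _+P_ : ∀ {n} → Poly n → Poly n → Poly n
  p +P q = p ++ q

  _*P_ : ∀ {n} → Poly n → Poly n → Poly n
  p *P q = concatMap (λ { (a , m) → map (λ { (b , m′) → (a * b , zipWith ℕ._+_ m m′) }) q }) p

  pow : Carrier → ℕ → Carrier
  pow z zero = 1#
  pow z (ℕ.suc e) = z * pow z e

  evalMono : ∀ {n} → Mono n → Vec Carrier n → Carrier
  evalMono [] [] = 1#
  evalMono (e ∷ m) (z ∷ zs) = pow z e * evalMono m zs

  eval : ∀ {n} → Poly n → Vec Carrier n → Carrier
  eval [] z = 0#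
  eval ((a , m) ∷ p) z = a * evalMono m z + eval p z

  combo : ∀ {n} → List (Poly n × Poly n) → Poly n
  combo = foldr (λ { (q , g) acc → (q *P g) +P acc }) []

  InIdeal : ∀ {n} {r} → (Poly n → Set r) → Poly n → Set (c ⊔ ℓ ⊔ r)
  InIdeal S p = Σ (List (Poly n × Poly n)) λ qs →
    All (λ { (q , g) → S g }) qs × (p ≈P combo qs)
    where n = _

  InI : ∀ {n} {r} → (Vec Carrier n → Set r) → Poly n → Set (c ⊔ ℓ ⊔ r)
  InI Z f = ∀ z → Z z → eval f z ≈ 0#

  -- IsTop f g : f is nonzero and g is τ(f), its top-degree homogeneous component
  IsTop : ∀ {n} → Poly n → Poly n → Set ℓ
  IsTop f g = Σ ℕ λ d →
      (∃ λ m → mdeg m ≡ d × ¬ (coeff f m ≈ 0#))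
    × (∀ m → d < mdeg m → coeff f m ≈ 0#)
    × (∀ m → mdeg m ≡ d → coeff g m ≈ coeff f m)
    × (∀ m → ¬ (mdeg m ≡ d) → coeff g m ≈ 0#)

  TGen : ∀ {n} {r} → (Vec Carrier n → Set r) → Poly n → Set (c ⊔ ℓ ⊔ r)
  TGen Z g = ∃ λ f → InI Z f × NonZeroP f × IsTop f g

  -- T(Z) = ⟨ τ(f) : f ∈ I(Z) ∖ {0} ⟩
  InT : ∀ {n} {r} → (Vec Carrier n → Set r) → Poly n → Set (c ⊔ ℓ ⊔ r)
  InT Z p = InIdeal (TGen Z) p

  -- monomials of degree d in n variables using only the first i variables
  monosIn : (n i d : ℕ) → List (Mono n)
  monosIn zero i zero = [] ∷ []
  monosIn zero i (ℕ.suc d) = []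
  monosIn (ℕ.suc n) zero d = map (0 ∷_) (monosIn n zero d)
  monosIn (ℕ.suc n) (ℕ.suc i) d =
    concatMap (λ a → map (a ∷_) (monosIn n i (d ∸ a))) (upTo (ℕ.suc d))

  sqfree : (n d : ℕ) → List (Mono n)
  sqfree zero zero = [] ∷ []
  sqfree zero (ℕ.suc d) = []
  sqfree (ℕ.suc n) zero = map (0 ∷_) (sqfree n zero)
  sqfree (ℕ.suc n) (ℕ.suc d) = map (0 ∷_) (sqfree n (ℕ.suc d)) ++ map (1 ∷_) (sqfree n d)

  hPoly : (n d i : ℕ) → Poly n
  hPoly n d i = map (λ m → (1# , m)) (monosIn n i d)

  ePoly : (n d : ℕ) → Poly n
  ePoly n d = map (λ m → (1# , m)) (sqfree n d)

  GenJ : (n k : ℕ) → Poly n → Set c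
  GenJ n k p = (∃ λ (i : Fin n) → p ≡ hPoly n k (ℕ.suc (toℕ i)))
             ⊎ (∃ λ (j : Fin k) → p ≡ ePoly n (n ∸ toℕ j))

  -- Z_{n,k} (0-indexed: z_i ∈ {α_j : j < k+i}, coordinates distinct,
  -- and α_j ∈ {z_i} for all j < k)
  Zset : (n k : ℕ) → (Fin (n ℕ.+ k ∸ 1) → Carrier) → Vec Carrier n → Set ℓ
  Zset n k α z =
      (∀ (i : Fin n) → ∃ λ j → toℕ j < k ℕ.+ toℕ i × lookup z i ≈ α j)
    × (∀ (i i′ : Fin n) → ¬ (i ≡ i′) → ¬ (lookup z i ≈ lookup z i′))
    × (∀ j → toℕ j < k → ∃ λ (i : Fin n) → lookup z i ≈ α j)

module Submission where

-- Every generator g of J_{n,k} is the top component of a polynomial vanishing on Z_{n,k}, built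
-- from generating functions in an auxiliary variable t. Since
-- Σ_d h_d(x₁,…,xᵢ) t^d = ∏_{j ≤ i} (1 - xⱼ t)⁻¹, the t^k coefficient of
-- ∏_{j < k+i-1} (1 - αⱼ t) · Σ_d h_d(x₁,…,xᵢ) t^d has top component h_k(x₁,…,xᵢ);
-- at z ∈ Z the coordinates z₁,…,zᵢ are distinct elements of {α₁,…,α_{k+i-1}}, so the product
-- specialises to a polynomial in t of degree k - 1 and this coefficient vanishes. Dually,
-- Σ_d e_d t^d = ∏_j (1 + xⱼ t), and the t^{n-j} coefficient of ∏_{s < k} (1 + αₛ t)⁻¹ · Σ_d e_d t^d
-- has top component e_{n-j}; at z ∈ Z every α₁,…,α_k is a coordinate, so the quotient has degree
-- n - k < n - j (as j < k).

open import Algebra.Bundles using (CommutativeRing)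
open import Data.Fin as Fin using (Fin; toℕ; inject≤; fromℕ<)
import Data.Fin.Properties as FinP
open import Data.List as List using (List; []; _∷_; length; _++_; concatMap; applyUpTo; take; tabulate)
import Data.List.Properties as ListP
open import Data.List.Relation.Unary.All as All using (All; []; _∷_)
import Data.List.Relation.Unary.All.Properties as AllP
open import Data.List.Relation.Unary.AllPairs as AllPairs using (AllPairs; []; _∷_)
open import Data.List.Relation.Unary.Any using (here; there; _─_)
open import Data.Nat as ℕ using (ℕ; zero; suc; _∸_; _≤_; _<_; s≤s; z≤n)
import Data.Nat.Properties as ℕP
open import Data.Product using (_,_; proj₁; proj₂)
open import Data.Sum using (inj₁; inj₂)
open import Data.Vec using (Vec; []; _∷_; lookup; replicate)
open import Data.Vec.Properties using (≡-dec; ∷-injective)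
open import Function using (id; _∘_)
open import Relation.Binary.PropositionalEquality as ≡ using (_≡_; _≢_)
open import Relation.Nullary using (¬_; yes; no; contradiction)
open import Relation.Nullary.Decidable using (toSum; decidable-stable)

open import Defs

All-take-tabulate : ∀ {a p} {A : Set a} {P : A → Set p} {m} (f : Fin m → A) i →
  (∀ t → toℕ t < i → P (f t)) → All P (take i (tabulate f))
All-take-tabulate          f zero    Pf = []
All-take-tabulate {m = zero}  f (suc i) Pf = []
All-take-tabulate {m = suc m} f (suc i) Pf =
  Pf Fin.zero (s≤s z≤n) ∷ All-take-tabulate (f ∘ Fin.suc) i (λ t t<i → Pf (Fin.suc t) (s≤s t<i))

length-take-≤ : ∀ {a} {A : Set a} i (xs : List A) → i ≤ length xs → length (take i xs) ≡ i
length-take-≤ i xs i≤len = ≡.trans (ListP.length-take i xs) (ℕP.m≤n⇒m⊓n≡m i≤len)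

module PowerSeries {c ℓ} (R : CommutativeRing c ℓ) where
  open CommutativeRing R hiding (zero)
  open import Algebra.Properties.Ring ring using (-‿distribˡ-*)
  open import Algebra.Properties.CommutativeSemigroup +-commutativeSemigroup
    using (interchange; xy∙z≈xz∙y)
  open import Algebra.Properties.CommutativeSemigroup *-commutativeSemigroup
    using (x∙yz≈y∙xz)
  open import Data.List.Membership.Setoid setoid using (_∈_)
  open import Relation.Binary.Reasoning.Setoid setoid

  Series : Set c
  Series = ℕ → Carrier

  infix 4 _≈ₛ_
  _≈ₛ_ : Series → Series → Set ℓ
  u ≈ₛ v = ∀ m → u m ≈ v m

  ≈ₛ-refl : ∀ {u} → u ≈ₛ u
  ≈ₛ-refl m = refl

  ≈ₛ-sym : ∀ {u v} → u ≈ₛ v → v ≈ₛ u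
  ≈ₛ-sym u≈v m = sym (u≈v m)

  ≈ₛ-trans : ∀ {u v w} → u ≈ₛ v → v ≈ₛ w → u ≈ₛ w
  ≈ₛ-trans u≈v v≈w m = trans (u≈v m) (v≈w m)

  1ₛ : Series
  1ₛ zero    = 1#
  1ₛ (suc _) = 0#

  infixl 7 _⋆_
  _⋆_ : Series → Series → Series
  (u ⋆ v) zero    = u zero * v zero
  (u ⋆ v) (suc m) = u zero * v (suc m) + ((u ∘ suc) ⋆ v) m

  -- mulLinear x u = (1 + x t) · u  and  divLinear x u = u / (1 + x t)
  mulLinear : Carrier → Series → Series
  mulLinear x u zero    = u zero
  mulLinear x u (suc m) = u (suc m) + x * u m

  divLinear : Carrier → Series → Series
  divLinear x u zero    = u zero
  divLinear x u (suc m) = u (suc m) + - x * divLinear x u m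

  mulLinear-cong : ∀ {x y u v} → x ≈ y → u ≈ₛ v → mulLinear x u ≈ₛ mulLinear y v
  mulLinear-cong x≈y u≈v zero    = u≈v zero
  mulLinear-cong x≈y u≈v (suc m) = +-cong (u≈v (suc m)) (*-cong x≈y (u≈v m))

  divLinear-congʳ : ∀ {x u v} → u ≈ₛ v → divLinear x u ≈ₛ divLinear x v
  divLinear-congʳ u≈v zero    = u≈v zero
  divLinear-congʳ u≈v (suc m) = +-cong (u≈v (suc m)) (*-congˡ (divLinear-congʳ u≈v m))

  -x*y+x*y≈0 : ∀ x y → - x * y + x * y ≈ 0#
  -x*y+x*y≈0 x y = begin
    - x * y + x * y   ≈⟨ +-congʳ (-‿distribˡ-* x y) ⟨
    - (x * y) + x * y ≈⟨ -‿inverseˡ (x * y) ⟩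
    0#                ∎

  mulLinear-divLinear : ∀ x v → mulLinear x (divLinear x v) ≈ₛ v
  mulLinear-divLinear x v zero    = refl
  mulLinear-divLinear x v (suc m) = begin
    (v (suc m) + - x * w m) + x * w m ≈⟨ +-assoc _ _ _ ⟩
    v (suc m) + (- x * w m + x * w m) ≈⟨ +-congˡ (-x*y+x*y≈0 x (w m)) ⟩
    v (suc m) + 0#                    ≈⟨ +-identityʳ _ ⟩
    v (suc m)                         ∎
    where w = divLinear x v

  divLinear-unique : ∀ x {w v} → mulLinear x w ≈ₛ v → w ≈ₛ divLinear x v
  divLinear-unique x xw≈v zero    = xw≈v zero
  divLinear-unique x {w} {v} xw≈v (suc m) = begin
    w (suc m)                                  ≈⟨ +-identityʳ _ ⟨
    w (suc m) + 0#                             ≈⟨ +-congˡ (trans (+-comm _ _) (-x*y+x*y≈0 x (w m))) ⟨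
    w (suc m) + (x * w m + - x * w m)          ≈⟨ +-assoc _ _ _ ⟨
    (w (suc m) + x * w m) + - x * w m          ≈⟨ +-cong (xw≈v (suc m)) (*-congˡ (divLinear-unique x xw≈v m)) ⟩
    v (suc m) + - x * divLinear x v m          ∎

  mulLinear-comm : ∀ x y u → mulLinear x (mulLinear y u) ≈ₛ mulLinear y (mulLinear x u)
  mulLinear-comm x y u zero          = refl
  mulLinear-comm x y u (suc zero)    = xy∙z≈xz∙y _ _ _
  mulLinear-comm x y u (suc (suc m)) = begin
    (u (2 ℕ.+ m) + y * u (suc m)) + x * (u (suc m) + y * u m)     ≈⟨ +-congˡ (distribˡ x _ _) ⟩
    (u (2 ℕ.+ m) + y * u (suc m)) + (x * u (suc m) + x * (y * u m)) ≈⟨ interchange _ _ _ _ ⟩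
    (u (2 ℕ.+ m) + x * u (suc m)) + (y * u (suc m) + x * (y * u m)) ≈⟨ +-congˡ (+-congˡ (x∙yz≈y∙xz x y _)) ⟩
    (u (2 ℕ.+ m) + x * u (suc m)) + (y * u (suc m) + y * (x * u m)) ≈⟨ +-congˡ (distribˡ y _ _) ⟨
    (u (2 ℕ.+ m) + x * u (suc m)) + y * (u (suc m) + x * u m)     ∎

  divLinear-mulLinear-comm : ∀ x y u → divLinear x (mulLinear y u) ≈ₛ mulLinear y (divLinear x u)
  divLinear-mulLinear-comm x y u = ≈ₛ-sym (divLinear-unique x
    (≈ₛ-trans (mulLinear-comm x y (divLinear x u)) (mulLinear-cong refl (mulLinear-divLinear x u))))

  mulLinears : List Carrier → Series → Series
  mulLinears []       u = u
  mulLinears (x ∷ xs) u = mulLinear x (mulLinears xs u)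

  divLinears : List Carrier → Series → Series
  divLinears []       u = u
  divLinears (x ∷ xs) u = divLinear x (divLinears xs u)

  mulLinears-congʳ : ∀ xs {u v} → u ≈ₛ v → mulLinears xs u ≈ₛ mulLinears xs v
  mulLinears-congʳ []       u≈v = u≈v
  mulLinears-congʳ (x ∷ xs) u≈v = mulLinear-cong refl (mulLinears-congʳ xs u≈v)

  divLinears-congʳ : ∀ xs {u v} → u ≈ₛ v → divLinears xs u ≈ₛ divLinears xs v
  divLinears-congʳ []       u≈v = u≈v
  divLinears-congʳ (x ∷ xs) u≈v = divLinear-congʳ (divLinears-congʳ xs u≈v)

  mulLinears-constant : ∀ xs u → mulLinears xs u zero ≈ u zero
  mulLinears-constant []       u = refl
  mulLinears-constant (x ∷ xs) u = mulLinears-constant xs u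

  divLinears-constant : ∀ xs u → divLinears xs u zero ≈ u zero
  divLinears-constant []       u = refl
  divLinears-constant (x ∷ xs) u = divLinears-constant xs u

  mulLinear-mulLinears-comm : ∀ x ys u → mulLinear x (mulLinears ys u) ≈ₛ mulLinears ys (mulLinear x u)
  mulLinear-mulLinears-comm x []       u = ≈ₛ-refl
  mulLinear-mulLinears-comm x (y ∷ ys) u =
    ≈ₛ-trans (mulLinear-comm x y _) (mulLinear-cong refl (mulLinear-mulLinears-comm x ys u))

  divLinear-mulLinears-comm : ∀ x ys u → divLinear x (mulLinears ys u) ≈ₛ mulLinears ys (divLinear x u)
  divLinear-mulLinears-comm x []       u = ≈ₛ-refl
  divLinear-mulLinears-comm x (y ∷ ys) u =
    ≈ₛ-trans (divLinear-mulLinear-comm x y _) (mulLinear-cong refl (divLinear-mulLinears-comm x ys u))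

  divLinears-mulLinears-comm : ∀ xs ys u → divLinears xs (mulLinears ys u) ≈ₛ mulLinears ys (divLinears xs u)
  divLinears-mulLinears-comm []       ys u = ≈ₛ-refl
  divLinears-mulLinears-comm (x ∷ xs) ys u =
    ≈ₛ-trans (divLinear-congʳ (divLinears-mulLinears-comm xs ys u)) (divLinear-mulLinears-comm x ys _)

  mulLinears-─ : ∀ {x} xs (x∈xs : x ∈ xs) u → mulLinears xs u ≈ₛ mulLinears (xs ─ x∈xs) (mulLinear x u)
  mulLinears-─ (y ∷ ys) (here x≈y)   u =
    ≈ₛ-trans (mulLinear-cong (sym x≈y) ≈ₛ-refl) (mulLinear-mulLinears-comm _ ys u)
  mulLinears-─ (y ∷ ys) (there x∈ys) u = mulLinear-cong refl (mulLinears-─ ys x∈ys u)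

  ∈-─⁺ : ∀ {x y xs} (x∈xs : x ∈ xs) → y ∈ xs → x ≉ y → y ∈ (xs ─ x∈xs)
  ∈-─⁺ (here x≈z)   (here y≈z)   x≉y = contradiction (trans x≈z (sym y≈z)) x≉y
  ∈-─⁺ (here _)     (there y∈xs) _   = y∈xs
  ∈-─⁺ (there _)    (here y≈z)   _   = here y≈z
  ∈-─⁺ (there x∈xs) (there y∈xs) x≉y = there (∈-─⁺ x∈xs y∈xs x≉y)

  mulLinears-1ₛ-vanish : ∀ xs m → length xs < m → mulLinears xs 1ₛ m ≈ 0#
  mulLinears-1ₛ-vanish []       (suc m) _         = refl
  mulLinears-1ₛ-vanish (x ∷ xs) (suc m) (s≤s len<m) = begin
    mulLinears xs 1ₛ (suc m) + x * mulLinears xs 1ₛ m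
      ≈⟨ +-cong (mulLinears-1ₛ-vanish xs (suc m) (ℕP.m<n⇒m<1+n len<m))
                (*-congˡ (mulLinears-1ₛ-vanish xs m len<m)) ⟩
    0# + x * 0#  ≈⟨ +-identityˡ _ ⟩
    x * 0#       ≈⟨ zeroʳ x ⟩
    0#           ∎

  mulLinears-divLinears-vanish : ∀ xs ys → AllPairs _≉_ ys → All (_∈ xs) ys →
    ∀ m → length xs < m ℕ.+ length ys → mulLinears xs (divLinears ys 1ₛ) m ≈ 0#
  mulLinears-divLinears-vanish xs [] [] [] m len<m =
    mulLinears-1ₛ-vanish xs m (≡.subst (length xs <_) (ℕP.+-identityʳ m) len<m)
  mulLinears-divLinears-vanish xs (y ∷ ys) (y≉ys ∷ ys!) (y∈xs ∷ ys⊆xs) m len< = begin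
    mulLinears xs (divLinear y (divLinears ys 1ₛ)) m
      ≈⟨ mulLinears-─ xs y∈xs _ m ⟩
    mulLinears (xs ─ y∈xs) (mulLinear y (divLinear y (divLinears ys 1ₛ))) m
      ≈⟨ mulLinears-congʳ (xs ─ y∈xs) (mulLinear-divLinear y _) m ⟩
    mulLinears (xs ─ y∈xs) (divLinears ys 1ₛ) m
      ≈⟨ mulLinears-divLinears-vanish (xs ─ y∈xs) ys ys! ys⊆xs─y m len<′ ⟩
    0# ∎
    where
    ys⊆xs─y : All (_∈ (xs ─ y∈xs)) ys
    ys⊆xs─y = All.zipWith (λ (z∈xs , y≉z) → ∈-─⁺ y∈xs z∈xs y≉z) (ys⊆xs , y≉ys)
    len<′ : length (xs ─ y∈xs) < m ℕ.+ length ys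
    len<′ = ℕP.+-cancelˡ-< 1 _ _ (≡.subst₂ _<_ (ListP.length-removeAt′ xs _) (ℕP.+-suc m (length ys)) len<)

  ⋆-congˡ : ∀ {u u′} v → u ≈ₛ u′ → u ⋆ v ≈ₛ u′ ⋆ v
  ⋆-congˡ v u≈u′ zero    = *-congʳ (u≈u′ zero)
  ⋆-congˡ v u≈u′ (suc m) = +-cong (*-congʳ (u≈u′ zero)) (⋆-congˡ v (u≈u′ ∘ suc) m)

  ⋆-congʳ : ∀ u {v v′} → v ≈ₛ v′ → u ⋆ v ≈ₛ u ⋆ v′
  ⋆-congʳ u v≈v′ zero    = *-congˡ (v≈v′ zero)
  ⋆-congʳ u v≈v′ (suc m) = +-cong (*-congˡ (v≈v′ (suc m))) (⋆-congʳ (u ∘ suc) v≈v′ m)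

  ⋆-identityʳ : ∀ u → u ⋆ 1ₛ ≈ₛ u
  ⋆-identityʳ u zero    = *-identityʳ _
  ⋆-identityʳ u (suc m) = begin
    u zero * 0# + ((u ∘ suc) ⋆ 1ₛ) m ≈⟨ +-cong (zeroʳ _) (⋆-identityʳ (u ∘ suc) m) ⟩
    0# + u (suc m)                   ≈⟨ +-identityˡ _ ⟩
    u (suc m)                        ∎

  ⋆-mulLinear : ∀ u x v → u ⋆ mulLinear x v ≈ₛ mulLinear x (u ⋆ v)
  ⋆-mulLinear u x v zero       = refl
  ⋆-mulLinear u x v (suc zero) = begin
    u 0 * (v 1 + x * v 0) + u 1 * v 0       ≈⟨ +-congʳ (distribˡ _ _ _) ⟩
    (u 0 * v 1 + u 0 * (x * v 0)) + u 1 * v 0 ≈⟨ xy∙z≈xz∙y _ _ _ ⟩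
    (u 0 * v 1 + u 1 * v 0) + u 0 * (x * v 0) ≈⟨ +-congˡ (x∙yz≈y∙xz _ _ _) ⟩
    (u 0 * v 1 + u 1 * v 0) + x * (u 0 * v 0) ∎
  ⋆-mulLinear u x v (suc (suc m)) = begin
    u 0 * (v (2 ℕ.+ m) + x * v (suc m)) + ((u ∘ suc) ⋆ mulLinear x v) (suc m)
      ≈⟨ +-cong (distribˡ _ _ _) (⋆-mulLinear (u ∘ suc) x v (suc m)) ⟩
    (u 0 * v (2 ℕ.+ m) + u 0 * (x * v (suc m))) + (w₁ + x * w₀) ≈⟨ interchange _ _ _ _ ⟩
    (u 0 * v (2 ℕ.+ m) + w₁) + (u 0 * (x * v (suc m)) + x * w₀) ≈⟨ +-congˡ (+-congʳ (x∙yz≈y∙xz _ _ _)) ⟩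
    (u 0 * v (2 ℕ.+ m) + w₁) + (x * (u 0 * v (suc m)) + x * w₀) ≈⟨ +-congˡ (distribˡ _ _ _) ⟨
    (u 0 * v (2 ℕ.+ m) + w₁) + x * (u 0 * v (suc m) + w₀)       ∎
    where
    w₁ = ((u ∘ suc) ⋆ v) (suc m)
    w₀ = ((u ∘ suc) ⋆ v) m

  ⋆-divLinear : ∀ u x v → u ⋆ divLinear x v ≈ₛ divLinear x (u ⋆ v)
  ⋆-divLinear u x v = divLinear-unique x
    (≈ₛ-trans (≈ₛ-sym (⋆-mulLinear u x (divLinear x v))) (⋆-congʳ u (mulLinear-divLinear x v)))

  ⋆-mulLinears : ∀ u xs v → u ⋆ mulLinears xs v ≈ₛ mulLinears xs (u ⋆ v)
  ⋆-mulLinears u []       v = ≈ₛ-refl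
  ⋆-mulLinears u (x ∷ xs) v = ≈ₛ-trans (⋆-mulLinear u x _) (mulLinear-cong refl (⋆-mulLinears u xs v))

  ⋆-divLinears : ∀ u xs v → u ⋆ divLinears xs v ≈ₛ divLinears xs (u ⋆ v)
  ⋆-divLinears u []       v = ≈ₛ-refl
  ⋆-divLinears u (x ∷ xs) v = ≈ₛ-trans (⋆-divLinear u x _) (divLinear-congʳ (⋆-divLinears u xs v))

module Polynomials {c ℓ} (F : Field c ℓ) where
  open Field F hiding (zero)
  open PolyDefs F
  open PowerSeries commutativeRing
  open import Algebra.Properties.Ring ring using (-‿involutive)
  open import Relation.Binary.Reasoning.Setoid setoid

  private variable n : ℕ

  coeff-++ : ∀ (p q : Poly n) μ → coeff (p ++ q) μ ≈ coeff p μ + coeff q μ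
  coeff-++ [] q μ = sym (+-identityˡ _)
  coeff-++ ((a , ν) ∷ p) q μ with ≡-dec ℕP._≟_ ν μ
  ... | yes _ = trans (+-congˡ (coeff-++ p q μ)) (sym (+-assoc _ _ _))
  ... | no  _ = coeff-++ p q μ

  eval-++ : ∀ (p q : Poly n) z → eval (p ++ q) z ≈ eval p z + eval q z
  eval-++ []            q z = sym (+-identityˡ _)
  eval-++ ((a , ν) ∷ p) q z = trans (+-congˡ (eval-++ p q z)) (sym (+-assoc _ _ _))

  scale : Carrier → Poly n → Poly n
  scale a []            = []
  scale a ((b , μ) ∷ p) = (a * b , μ) ∷ scale a p

  coeff-scale : ∀ a (p : Poly n) μ → coeff (scale a p) μ ≈ a * coeff p μ
  coeff-scale a [] μ = sym (zeroʳ a)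
  coeff-scale a ((b , ν) ∷ p) μ with ≡-dec ℕP._≟_ ν μ
  ... | yes _ = trans (+-congˡ (coeff-scale a p μ)) (sym (distribˡ _ _ _))
  ... | no  _ = coeff-scale a p μ

  eval-scale : ∀ a (p : Poly n) z → eval (scale a p) z ≈ a * eval p z
  eval-scale a []            z = sym (zeroʳ a)
  eval-scale a ((b , ν) ∷ p) z = trans (+-cong (*-assoc _ _ _) (eval-scale a p z)) (sym (distribˡ _ _ _))

  -- (Q ⋆ᴾ w) m = Σ_{j ≤ m} w (m ∸ j) · Q j, the coefficient of t^m in (Σ_j Q j t^j) · w
  infixl 7 _⋆ᴾ_
  _⋆ᴾ_ : (ℕ → Poly n) → Series → ℕ → Poly n
  (Q ⋆ᴾ w) zero    = scale (w zero) (Q zero)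
  (Q ⋆ᴾ w) (suc m) = scale (w (suc m)) (Q zero) ++ ((Q ∘ suc) ⋆ᴾ w) m

  eval-⋆ᴾ : ∀ (Q : ℕ → Poly n) w m z → eval ((Q ⋆ᴾ w) m) z ≈ ((λ j → eval (Q j) z) ⋆ w) m
  eval-⋆ᴾ Q w zero    z = trans (eval-scale (w zero) (Q zero) z) (*-comm _ _)
  eval-⋆ᴾ Q w (suc m) z = trans (eval-++ (scale (w (suc m)) (Q zero)) _ z)
    (+-cong (trans (eval-scale (w (suc m)) (Q zero) z) (*-comm _ _)) (eval-⋆ᴾ (Q ∘ suc) w m z))

  HomogeneousFrom : ℕ → (ℕ → Poly n) → Set ℓ
  HomogeneousFrom d Q = ∀ j μ → mdeg μ ≢ d ℕ.+ j → coeff (Q j) μ ≈ 0#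

  HomogeneousFrom-suc : ∀ {d} (Q : ℕ → Poly n) → HomogeneousFrom d Q → HomogeneousFrom (suc d) (Q ∘ suc)
  HomogeneousFrom-suc {d = d} Q homQ j μ μ≢ = homQ (suc j) μ (λ eq → μ≢ (≡.trans eq (ℕP.+-suc d j)))

  coeff-⋆ᴾ-above : ∀ (Q : ℕ → Poly n) w d → HomogeneousFrom d Q →
    ∀ m μ → d ℕ.+ m < mdeg μ → coeff ((Q ⋆ᴾ w) m) μ ≈ 0#
  coeff-⋆ᴾ-above Q w d homQ zero μ d<μ = begin
    coeff (scale (w zero) (Q zero)) μ ≈⟨ coeff-scale (w zero) (Q zero) μ ⟩
    w zero * coeff (Q zero) μ         ≈⟨ *-congˡ (homQ 0 μ (λ eq → ℕP.<-irrefl (≡.sym eq) d<μ)) ⟩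
    w zero * 0#                       ≈⟨ zeroʳ _ ⟩
    0#                                ∎
  coeff-⋆ᴾ-above Q w d homQ (suc m) μ d<μ = begin
    coeff (scale (w (suc m)) (Q zero) ++ ((Q ∘ suc) ⋆ᴾ w) m) μ
      ≈⟨ coeff-++ (scale (w (suc m)) (Q zero)) _ μ ⟩
    coeff (scale (w (suc m)) (Q zero)) μ + coeff (((Q ∘ suc) ⋆ᴾ w) m) μ
      ≈⟨ +-cong (coeff-scale (w (suc m)) (Q zero) μ)
                (coeff-⋆ᴾ-above (Q ∘ suc) w (suc d) (HomogeneousFrom-suc Q homQ) m μ
                  (≡.subst (_< mdeg μ) (ℕP.+-suc d m) d<μ)) ⟩
    w (suc m) * coeff (Q zero) μ + 0# ≈⟨ +-cong (*-congˡ (homQ 0 μ μ≢d)) refl ⟩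
    w (suc m) * 0# + 0#               ≈⟨ +-identityʳ _ ⟩
    w (suc m) * 0#                    ≈⟨ zeroʳ _ ⟩
    0#                                ∎
    where
    μ≢d : mdeg μ ≢ d ℕ.+ 0
    μ≢d eq = ℕP.<⇒≱ (≡.subst (d ℕ.+ suc m <_) eq d<μ) (ℕP.+-monoʳ-≤ d z≤n)

  coeff-⋆ᴾ-top : ∀ (Q : ℕ → Poly n) w d → HomogeneousFrom d Q →
    ∀ m μ → mdeg μ ≡ d ℕ.+ m → coeff ((Q ⋆ᴾ w) m) μ ≈ w zero * coeff (Q m) μ
  coeff-⋆ᴾ-top Q w d homQ zero    μ _    = coeff-scale (w zero) (Q zero) μ
  coeff-⋆ᴾ-top Q w d homQ (suc m) μ μ≡d+m = begin
    coeff (scale (w (suc m)) (Q zero) ++ ((Q ∘ suc) ⋆ᴾ w) m) μ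
      ≈⟨ coeff-++ (scale (w (suc m)) (Q zero)) _ μ ⟩
    coeff (scale (w (suc m)) (Q zero)) μ + coeff (((Q ∘ suc) ⋆ᴾ w) m) μ
      ≈⟨ +-cong (coeff-scale (w (suc m)) (Q zero) μ)
                (coeff-⋆ᴾ-top (Q ∘ suc) w (suc d) (HomogeneousFrom-suc Q homQ) m μ
                  (≡.trans μ≡d+m (ℕP.+-suc d m))) ⟩
    w (suc m) * coeff (Q zero) μ + w zero * coeff (Q (suc m)) μ ≈⟨ +-congʳ (*-congˡ (homQ 0 μ μ≢d)) ⟩
    w (suc m) * 0# + w zero * coeff (Q (suc m)) μ             ≈⟨ +-congʳ (zeroʳ _) ⟩
    0# + w zero * coeff (Q (suc m)) μ                         ≈⟨ +-identityˡ _ ⟩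
    w zero * coeff (Q (suc m)) μ                              ∎
    where
    μ≢d : mdeg μ ≢ d ℕ.+ 0
    μ≢d eq = ℕP.m≢1+m+n d (≡.trans (≡.sym (ℕP.+-identityʳ d))
              (≡.trans (≡.sym eq) (≡.trans μ≡d+m (ℕP.+-suc d m))))

  -- τ((Q ⋆ᴾ w) m) = Q m, so (Q ⋆ᴾ w) m witnesses Q m ∈ T(Z) as soon as it vanishes on Z
  tGen-⋆ᴾ : ∀ {r} (Z : Vec Carrier n → Set r) (Q : ℕ → Poly n) w m →
    HomogeneousFrom 0 Q → w zero ≈ 1# → NonZeroP (Q m) → InI Z ((Q ⋆ᴾ w) m) → TGen Z (Q m)
  tGen-⋆ᴾ Z Q w m homQ w₀≈1 (μ , Qμ≉0) vanish =
    (Q ⋆ᴾ w) m , vanish , (μ , μ≉0) , m , (μ , μ≡m , μ≉0) , coeff-⋆ᴾ-above Q w 0 homQ m , top , homQ m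
    where
    top : ∀ ν → mdeg ν ≡ m → coeff (Q m) ν ≈ coeff ((Q ⋆ᴾ w) m) ν
    top ν ν≡m = sym (trans (coeff-⋆ᴾ-top Q w 0 homQ m ν ν≡m) (trans (*-congʳ w₀≈1) (*-identityˡ _)))
    μ≡m : mdeg μ ≡ m
    μ≡m = decidable-stable (mdeg μ ℕP.≟ m) (λ μ≢m → Qμ≉0 (homQ m μ μ≢m))
    μ≉0 : ¬ (coeff ((Q ⋆ᴾ w) m) μ ≈ 0#)
    μ≉0 μ≈0 = Qμ≉0 (trans (top μ μ≡m) μ≈0)

  fromMonos : List (Mono n) → Poly n
  fromMonos = List.map (1# ,_)

  eval-fromMonos-++ : ∀ (L M : List (Mono n)) z →
    eval (fromMonos (L ++ M)) z ≈ eval (fromMonos L) z + eval (fromMonos M) z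
  eval-fromMonos-++ L M z rewrite ListP.map-++ (1# ,_) L M = eval-++ (fromMonos L) (fromMonos M) z

  coeff-fromMonos-++ : ∀ (L M : List (Mono n)) μ →
    coeff (fromMonos (L ++ M)) μ ≈ coeff (fromMonos L) μ + coeff (fromMonos M) μ
  coeff-fromMonos-++ L M μ rewrite ListP.map-++ (1# ,_) L M = coeff-++ (fromMonos L) (fromMonos M) μ

  sumBelow : (ℕ → Carrier) → ℕ → Carrier
  sumBelow h zero    = 0#
  sumBelow h (suc d) = h zero + sumBelow (h ∘ suc) d

  sumBelow-cong : ∀ {h h′} d → (∀ a → h a ≈ h′ a) → sumBelow h d ≈ sumBelow h′ d
  sumBelow-cong zero    h≈h′ = refl
  sumBelow-cong (suc d) h≈h′ = +-cong (h≈h′ 0) (sumBelow-cong d (h≈h′ ∘ suc))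

  *-distribˡ-sumBelow : ∀ x h d → x * sumBelow h d ≈ sumBelow (λ a → x * h a) d
  *-distribˡ-sumBelow x h zero    = zeroʳ x
  *-distribˡ-sumBelow x h (suc d) = trans (distribˡ _ _ _) (+-congˡ (*-distribˡ-sumBelow x (h ∘ suc) d))

  sumBelow-last : ∀ h d → (∀ a → a < d → h a ≈ 0#) → sumBelow h (suc d) ≈ h d
  sumBelow-last h zero    _      = +-identityʳ _
  sumBelow-last h (suc d) h<d≈0 =
    trans (+-cong (h<d≈0 0 (s≤s z≤n)) (sumBelow-last (h ∘ suc) d (λ a a<d → h<d≈0 (suc a) (s≤s a<d))))
          (+-identityˡ _)

  sumBelow-concatMap : (φ : List (Mono n) → Carrier) → (∀ L M → φ (L ++ M) ≈ φ L + φ M) → φ [] ≈ 0# →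
    ∀ (f : ℕ → List (Mono n)) g d → φ (concatMap f (applyUpTo g d)) ≈ sumBelow (φ ∘ f ∘ g) d
  sumBelow-concatMap φ φ-++ φ[] f g zero    = φ[]
  sumBelow-concatMap φ φ-++ φ[] f g (suc d) =
    trans (φ-++ (f (g 0)) _) (+-congˡ (sumBelow-concatMap φ φ-++ φ[] f (g ∘ suc) d))

  eval-fromMonos-∷ : ∀ a (L : List (Mono n)) x xs →
    eval (fromMonos (List.map (a ∷_) L)) (x ∷ xs) ≈ pow x a * eval (fromMonos L) xs
  eval-fromMonos-∷ a []      x xs = sym (zeroʳ _)
  eval-fromMonos-∷ a (μ ∷ L) x xs = begin
    1# * (pow x a * evalMono μ xs) + eval (fromMonos (List.map (a ∷_) L)) (x ∷ xs)
      ≈⟨ +-cong (*-identityˡ _) (eval-fromMonos-∷ a L x xs) ⟩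
    pow x a * evalMono μ xs + pow x a * eval (fromMonos L) xs ≈⟨ distribˡ _ _ _ ⟨
    pow x a * (evalMono μ xs + eval (fromMonos L) xs)         ≈⟨ *-congˡ (+-congʳ (*-identityˡ _)) ⟨
    pow x a * (1# * evalMono μ xs + eval (fromMonos L) xs)    ∎

  coeff-∷-≡ : ∀ a μ ν (p : Poly n) → μ ≡ ν → coeff ((a , μ) ∷ p) ν ≈ a + coeff p ν
  coeff-∷-≡ a μ ν p μ≡ν with ≡-dec ℕP._≟_ μ ν
  ... | yes _   = refl
  ... | no  μ≢ν = contradiction μ≡ν μ≢ν

  coeff-∷-≢ : ∀ a μ ν (p : Poly n) → μ ≢ ν → coeff ((a , μ) ∷ p) ν ≈ coeff p ν
  coeff-∷-≢ a μ ν p μ≢ν with ≡-dec ℕP._≟_ μ ν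
  ... | yes μ≡ν = contradiction μ≡ν μ≢ν
  ... | no  _   = refl

  coeff-fromMonos-∷ : ∀ a (L : List (Mono n)) ν →
    coeff (fromMonos (List.map (a ∷_) L)) (a ∷ ν) ≈ coeff (fromMonos L) ν
  coeff-fromMonos-∷ a []      ν = refl
  coeff-fromMonos-∷ a (μ ∷ L) ν with toSum (≡-dec ℕP._≟_ μ ν)
  ... | inj₁ μ≡ν = begin
    coeff (fromMonos (List.map (a ∷_) (μ ∷ L))) (a ∷ ν)
      ≈⟨ coeff-∷-≡ 1# (a ∷ μ) (a ∷ ν) _ (≡.cong (a ∷_) μ≡ν) ⟩
    1# + coeff (fromMonos (List.map (a ∷_) L)) (a ∷ ν) ≈⟨ +-congˡ (coeff-fromMonos-∷ a L ν) ⟩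
    1# + coeff (fromMonos L) ν                         ≈⟨ coeff-∷-≡ 1# μ ν _ μ≡ν ⟨
    coeff (fromMonos (μ ∷ L)) ν                        ∎
  ... | inj₂ μ≢ν = begin
    coeff (fromMonos (List.map (a ∷_) (μ ∷ L))) (a ∷ ν)
      ≈⟨ coeff-∷-≢ 1# (a ∷ μ) (a ∷ ν) _ (μ≢ν ∘ proj₂ ∘ ∷-injective) ⟩
    coeff (fromMonos (List.map (a ∷_) L)) (a ∷ ν)     ≈⟨ coeff-fromMonos-∷ a L ν ⟩
    coeff (fromMonos L) ν                             ≈⟨ coeff-∷-≢ 1# μ ν _ μ≢ν ⟨
    coeff (fromMonos (μ ∷ L)) ν                       ∎

  coeff-fromMonos-∷-≢ : ∀ {a b} (L : List (Mono n)) ν → a ≢ b →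
    coeff (fromMonos (List.map (a ∷_) L)) (b ∷ ν) ≈ 0#
  coeff-fromMonos-∷-≢ []      ν a≢b = refl
  coeff-fromMonos-∷-≢ (μ ∷ L) ν a≢b =
    trans (coeff-∷-≢ 1# (_ ∷ μ) (_ ∷ ν) _ (a≢b ∘ proj₁ ∘ ∷-injective)) (coeff-fromMonos-∷-≢ L ν a≢b)

  coeff-fromMonos-homogeneous : ∀ {d} (L : List (Mono n)) → All (λ ν → mdeg ν ≡ d) L →
    ∀ μ → mdeg μ ≢ d → coeff (fromMonos L) μ ≈ 0#
  coeff-fromMonos-homogeneous []      []           μ μ≢d = refl
  coeff-fromMonos-homogeneous (ν ∷ L) (ν≡d ∷ L≡d) μ μ≢d =
    trans (coeff-∷-≢ 1# ν μ _ (λ ν≡μ → μ≢d (≡.trans (≡.cong mdeg (≡.sym ν≡μ)) ν≡d)))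
          (coeff-fromMonos-homogeneous L L≡d μ μ≢d)

  eval-fromMonos-concatMap : ∀ (f : ℕ → List (Mono n)) g d z →
    eval (fromMonos (concatMap f (applyUpTo g d))) z ≈ sumBelow (λ a → eval (fromMonos (f (g a))) z) d
  eval-fromMonos-concatMap f g d z =
    sumBelow-concatMap (λ L → eval (fromMonos L) z) (λ L M → eval-fromMonos-++ L M z) refl f g d

  coeff-fromMonos-concatMap : ∀ (f : ℕ → List (Mono n)) g d μ →
    coeff (fromMonos (concatMap f (applyUpTo g d))) μ ≈ sumBelow (λ a → coeff (fromMonos (f (g a))) μ) d
  coeff-fromMonos-concatMap f g d μ =
    sumBelow-concatMap (λ L → coeff (fromMonos L) μ) (λ L M → coeff-fromMonos-++ L M μ) refl f g d

  monosIn-degree : ∀ n i d → All (λ μ → mdeg μ ≡ d) (monosIn n i d)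
  monosIn-degree zero    i       zero    = ≡.refl ∷ []
  monosIn-degree zero    i       (suc d) = []
  monosIn-degree (suc n) zero    d       = AllP.map⁺ (monosIn-degree n zero d)
  monosIn-degree (suc n) (suc i) d       = AllP.concat⁺ (AllP.map⁺ (AllP.applyUpTo⁺₁ _ (suc d)
    λ {a} a<1+d → AllP.map⁺ (All.map (λ μ≡d∸a → ≡.trans (≡.cong (a ℕ.+_) μ≡d∸a) (ℕP.m+[n∸m]≡n (ℕP.≤-pred a<1+d)))
                                     (monosIn-degree n i (d ∸ a)))))

  sqfree-degree : ∀ n d → All (λ μ → mdeg μ ≡ d) (sqfree n d)
  sqfree-degree zero    zero    = ≡.refl ∷ []
  sqfree-degree zero    (suc d) = []
  sqfree-degree (suc n) zero    = AllP.map⁺ (sqfree-degree n zero)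
  sqfree-degree (suc n) (suc d) =
    AllP.++⁺ (AllP.map⁺ (sqfree-degree n (suc d))) (AllP.map⁺ (All.map (≡.cong suc) (sqfree-degree n d)))

  coeff-hPoly-constant : ∀ n i → coeff (hPoly n 0 i) (replicate n 0) ≈ 1#
  coeff-hPoly-constant zero    i       = trans (coeff-∷-≡ 1# [] [] [] ≡.refl) (+-identityʳ _)
  coeff-hPoly-constant (suc n) zero    =
    trans (coeff-fromMonos-∷ 0 (monosIn n zero 0) (replicate n 0)) (coeff-hPoly-constant n zero)
  coeff-hPoly-constant (suc n) (suc i) = begin
    coeff (hPoly (suc n) 0 (suc i)) (replicate (suc n) 0)
      ≈⟨ coeff-fromMonos-concatMap (λ a → List.map (a ∷_) (monosIn n i (0 ∸ a))) id 1 _ ⟩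
    coeff (fromMonos (List.map (0 ∷_) (monosIn n i 0))) (replicate (suc n) 0) + 0# ≈⟨ +-identityʳ _ ⟩
    coeff (fromMonos (List.map (0 ∷_) (monosIn n i 0))) (replicate (suc n) 0)
      ≈⟨ coeff-fromMonos-∷ 0 (monosIn n i 0) (replicate n 0) ⟩
    coeff (hPoly n 0 i) (replicate n 0)                                            ≈⟨ coeff-hPoly-constant n i ⟩
    1#                                                                             ∎

  coeff-hPoly-pow-x₁ : ∀ n i d → coeff (hPoly (suc n) d (suc i)) (d ∷ replicate n 0) ≈ 1#
  coeff-hPoly-pow-x₁ n i d = begin
    coeff (hPoly (suc n) d (suc i)) (d ∷ replicate n 0)
      ≈⟨ coeff-fromMonos-concatMap (λ a → List.map (a ∷_) (monosIn n i (d ∸ a))) id (suc d) _ ⟩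
    sumBelow (λ a → coeff (fromMonos (List.map (a ∷_) (monosIn n i (d ∸ a)))) (d ∷ replicate n 0)) (suc d)
      ≈⟨ sumBelow-last _ d (λ a a<d → coeff-fromMonos-∷-≢ (monosIn n i (d ∸ a)) _ (ℕP.<⇒≢ a<d)) ⟩
    coeff (fromMonos (List.map (d ∷_) (monosIn n i (d ∸ d)))) (d ∷ replicate n 0)
      ≈⟨ coeff-fromMonos-∷ d (monosIn n i (d ∸ d)) (replicate n 0) ⟩
    coeff (hPoly n (d ∸ d) i) (replicate n 0)
      ≡⟨ ≡.cong (λ e → coeff (hPoly n e i) (replicate n 0)) (ℕP.n∸n≡0 d) ⟩
    coeff (hPoly n 0 i) (replicate n 0)
      ≈⟨ coeff-hPoly-constant n i ⟩
    1# ∎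

  sqfreeMono : (n d : ℕ) → Mono n
  sqfreeMono zero    d       = []
  sqfreeMono (suc n) zero    = 0 ∷ sqfreeMono n zero
  sqfreeMono (suc n) (suc d) = 1 ∷ sqfreeMono n d

  coeff-ePoly-sqfreeMono : ∀ n d → d ≤ n → coeff (ePoly n d) (sqfreeMono n d) ≈ 1#
  coeff-ePoly-sqfreeMono zero    zero    z≤n       = trans (coeff-∷-≡ 1# [] [] [] ≡.refl) (+-identityʳ _)
  coeff-ePoly-sqfreeMono (suc n) zero    z≤n       =
    trans (coeff-fromMonos-∷ 0 (sqfree n zero) _) (coeff-ePoly-sqfreeMono n zero z≤n)
  coeff-ePoly-sqfreeMono (suc n) (suc d) (s≤s d≤n) = begin
    coeff (fromMonos (List.map (0 ∷_) (sqfree n (suc d)) ++ List.map (1 ∷_) (sqfree n d))) (sqfreeMono (suc n) (suc d))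
      ≈⟨ coeff-fromMonos-++ (List.map (0 ∷_) (sqfree n (suc d))) _ _ ⟩
    coeff (fromMonos (List.map (0 ∷_) (sqfree n (suc d)))) (1 ∷ sqfreeMono n d)
      + coeff (fromMonos (List.map (1 ∷_) (sqfree n d))) (1 ∷ sqfreeMono n d)
      ≈⟨ +-cong (coeff-fromMonos-∷-≢ (sqfree n (suc d)) _ (λ ())) (coeff-fromMonos-∷ 1 (sqfree n d) _) ⟩
    0# + coeff (ePoly n d) (sqfreeMono n d) ≈⟨ +-identityˡ _ ⟩
    coeff (ePoly n d) (sqfreeMono n d)      ≈⟨ coeff-ePoly-sqfreeMono n d d≤n ⟩
    1#                                      ∎

  hPoly-nonzero : ∀ {n} (i : Fin n) d → NonZeroP (hPoly n d (suc (toℕ i)))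
  hPoly-nonzero {suc n} i d = d ∷ replicate n 0 , λ x≈0 → 0≉1 (trans (sym x≈0) (coeff-hPoly-pow-x₁ n (toℕ i) d))

  ePoly-nonzero : ∀ {n d} → d ≤ n → NonZeroP (ePoly n d)
  ePoly-nonzero {n} {d} d≤n = sqfreeMono n d , λ x≈0 → 0≉1 (trans (sym x≈0) (coeff-ePoly-sqfreeMono n d d≤n))

  -- the geometric series: 1 / (1 - x t) = Σ_a x^a t^a
  sumBelow-pow-divLinear : ∀ x v d → sumBelow (λ a → pow x a * v (d ∸ a)) (suc d) ≈ divLinear (- x) v d
  sumBelow-pow-divLinear x v zero    = trans (+-identityʳ _) (*-identityˡ _)
  sumBelow-pow-divLinear x v (suc d) = begin
    1# * v (suc d) + sumBelow (λ a → (x * pow x a) * v (d ∸ a)) (suc d)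
      ≈⟨ +-cong (*-identityˡ _) (sumBelow-cong (suc d) (λ a → *-assoc x (pow x a) (v (d ∸ a)))) ⟩
    v (suc d) + sumBelow (λ a → x * (pow x a * v (d ∸ a))) (suc d)
      ≈⟨ +-congˡ (*-distribˡ-sumBelow x (λ a → pow x a * v (d ∸ a)) (suc d)) ⟨
    v (suc d) + x * sumBelow (λ a → pow x a * v (d ∸ a)) (suc d)
      ≈⟨ +-congˡ (*-cong (sym (-‿involutive x)) (sumBelow-pow-divLinear x v d)) ⟩
    v (suc d) + - (- x) * divLinear (- x) v d ∎

  eval-hPoly : ∀ n i d (z : Vec Carrier n) →
    eval (hPoly n d i) z ≈ divLinears (List.map -_ (take i (tabulate (lookup z)))) 1ₛ d
  eval-hPoly zero    zero    zero    [] = trans (+-identityʳ _) (*-identityˡ _)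
  eval-hPoly zero    (suc i) zero    [] = trans (+-identityʳ _) (*-identityˡ _)
  eval-hPoly zero    zero    (suc d) [] = refl
  eval-hPoly zero    (suc i) (suc d) [] = refl
  eval-hPoly (suc n) zero    d (x ∷ xs) =
    trans (eval-fromMonos-∷ 0 (monosIn n zero d) x xs) (trans (*-identityˡ _) (eval-hPoly n zero d xs))
  eval-hPoly (suc n) (suc i) d (x ∷ xs) = begin
    eval (hPoly (suc n) d (suc i)) (x ∷ xs)
      ≈⟨ eval-fromMonos-concatMap (λ a → List.map (a ∷_) (monosIn n i (d ∸ a))) id (suc d) _ ⟩
    sumBelow (λ a → eval (fromMonos (List.map (a ∷_) (monosIn n i (d ∸ a)))) (x ∷ xs)) (suc d)
      ≈⟨ sumBelow-cong (suc d) (λ a → trans (eval-fromMonos-∷ a (monosIn n i (d ∸ a)) x xs)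
                                            (*-congˡ (eval-hPoly n i (d ∸ a) xs))) ⟩
    sumBelow (λ a → pow x a * divLinears (List.map -_ (take i (tabulate (lookup xs)))) 1ₛ (d ∸ a)) (suc d)
      ≈⟨ sumBelow-pow-divLinear x _ d ⟩
    divLinear (- x) (divLinears (List.map -_ (take i (tabulate (lookup xs)))) 1ₛ) d ∎

  eval-ePoly : ∀ n d (z : Vec Carrier n) → eval (ePoly n d) z ≈ mulLinears (tabulate (lookup z)) 1ₛ d
  eval-ePoly zero    zero    [] = trans (+-identityʳ _) (*-identityˡ _)
  eval-ePoly zero    (suc d) [] = refl
  eval-ePoly (suc n) zero    (x ∷ xs) =
    trans (eval-fromMonos-∷ 0 (sqfree n zero) x xs) (trans (*-identityˡ _) (eval-ePoly n zero xs))
  eval-ePoly (suc n) (suc d) (x ∷ xs) = begin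
    eval (fromMonos (List.map (0 ∷_) (sqfree n (suc d)) ++ List.map (1 ∷_) (sqfree n d))) (x ∷ xs)
      ≈⟨ eval-fromMonos-++ (List.map (0 ∷_) (sqfree n (suc d))) _ _ ⟩
    eval (fromMonos (List.map (0 ∷_) (sqfree n (suc d)))) (x ∷ xs)
      + eval (fromMonos (List.map (1 ∷_) (sqfree n d))) (x ∷ xs)
      ≈⟨ +-cong (eval-fromMonos-∷ 0 (sqfree n (suc d)) x xs) (eval-fromMonos-∷ 1 (sqfree n d) x xs) ⟩
    1# * eval (ePoly n (suc d)) xs + (x * 1#) * eval (ePoly n d) xs
      ≈⟨ +-cong (trans (*-identityˡ _) (eval-ePoly n (suc d) xs)) (*-cong (*-identityʳ x) (eval-ePoly n d xs)) ⟩
    mulLinears (tabulate (lookup xs)) 1ₛ (suc d) + x * mulLinears (tabulate (lookup xs)) 1ₛ d ∎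

  InIdeal-mono : ∀ {r s} {S : Poly n → Set r} {S′ : Poly n → Set s} →
    (∀ g → S g → S′ g) → ∀ p → InIdeal S p → InIdeal S′ p
  InIdeal-mono S⊆S′ p (qgs , S[gs] , p≈combo) = qgs , All.map (λ {(_ , g)} → S⊆S′ g) S[gs] , p≈combo

open import Data.Nat using (_+_)

k+i≤n+k∸1 : ∀ {n} k i → i < n → k + i ≤ n + k ∸ 1
k+i≤n+k∸1 {n} k i i<n = ℕP.m+n≤o⇒m≤o∸n (k + i) (begin
  k + i + 1   ≡⟨ ℕP.+-comm (k + i) 1 ⟩
  suc (k + i) ≡⟨ ℕP.+-suc k i ⟨
  k + suc i   ≤⟨ ℕP.+-monoʳ-≤ k i<n ⟩
  k + n       ≡⟨ ℕP.+-comm k n ⟩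
  n + k       ∎)
  where open ℕP.≤-Reasoning

module GeneratorsOfJ {c ℓ} (F : Field c ℓ) (n k : ℕ) (1≤k : 1 ≤ k) (k≤n : k ≤ n)
    (α : Fin (n + k ∸ 1) → Field.Carrier F)
    (α-injective : ∀ j j′ → ¬ (j ≡ j′) → ¬ (Field._≈_ F (α j) (α j′))) where
  open Field F using (Carrier; _≈_; _≉_; 0#; -_; -‿cong; sym; reflexive; ring; setoid; commutativeRing)
  open import Algebra.Properties.Ring ring using (-‿injective)
  open import Data.List.Membership.Setoid setoid using (_∈_)
  open import Data.List.Membership.Setoid.Properties using (∈-resp-≈; ∈-tabulate⁺; ∈-map⁺)
  import Data.List.Relation.Unary.AllPairs.Properties as AllPairsP
  open import Relation.Binary.Reasoning.Setoid setoid
  open PolyDefs F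
  open PowerSeries commutativeRing
  open Polynomials F

  Z : Vec Carrier n → Set ℓ
  Z = Zset n k α

  alphas : ∀ m → m ≤ n + k ∸ 1 → List Carrier
  alphas m m≤ = tabulate (λ s → α (inject≤ s m≤))

  alphas-distinct : ∀ m m≤ → AllPairs _≉_ (alphas m m≤)
  alphas-distinct m m≤ =
    AllPairsP.tabulate⁺ λ s≢s′ → α-injective _ _ (s≢s′ ∘ FinP.inject≤-injective m≤ m≤ _ _)

  α∈alphas : ∀ m m≤ j → toℕ j < m → α j ∈ alphas m m≤
  α∈alphas m m≤ j j<m = ∈-resp-≈ setoid (reflexive (≡.cong α (FinP.toℕ-injective toℕ-j≡)))
    (∈-tabulate⁺ setoid (fromℕ< j<m))
    where
    toℕ-j≡ : toℕ (inject≤ (fromℕ< j<m) m≤) ≡ toℕ j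
    toℕ-j≡ = ≡.trans (FinP.toℕ-inject≤ (fromℕ< j<m) m≤) (FinP.toℕ-fromℕ< j<m)

  length-alphas : ∀ m m≤ → length (alphas m m≤) ≡ m
  length-alphas m m≤ = ListP.length-tabulate _

  k≤n+k∸1 : k ≤ n + k ∸ 1
  k≤n+k∸1 = ℕP.≤-trans (ℕP.m≤m+n k 0) (k+i≤n+k∸1 k 0 (ℕP.≤-trans 1≤k k≤n))

  coordinates : Vec Carrier n → List Carrier
  coordinates z = tabulate (lookup z)

  length-coordinates : ∀ z → length (coordinates z) ≡ n
  length-coordinates z = ListP.length-tabulate (lookup z)

  coordinates-distinct : ∀ z → Z z → AllPairs _≉_ (coordinates z)
  coordinates-distinct z (_ , z-distinct , _) = AllPairsP.tabulate⁺ (z-distinct _ _)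

  prefix⊆alphas : ∀ z → Z z → ∀ i (i<n : i < n) →
    All (_∈ alphas (k + i) (k+i≤n+k∸1 k i i<n)) (take (suc i) (coordinates z))
  prefix⊆alphas z (z-in , _) i i<n = All-take-tabulate (lookup z) (suc i) λ t t≤i →
    let j , j<k+t , zₜ≈αⱼ = z-in t
    in ∈-resp-≈ setoid (sym zₜ≈αⱼ)
         (α∈alphas (k + i) (k+i≤n+k∸1 k i i<n) j (ℕP.<-≤-trans j<k+t (ℕP.+-monoʳ-≤ k (ℕP.≤-pred t≤i))))

  alphas⊆coordinates : ∀ z → Z z → All (_∈ coordinates z) (alphas k k≤n+k∸1)
  alphas⊆coordinates z (_ , _ , z-covers) = AllP.tabulate⁺ λ s →
    let i , zᵢ≈αₛ = z-covers (inject≤ s k≤n+k∸1)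
                      (≡.subst (_< k) (≡.sym (FinP.toℕ-inject≤ s k≤n+k∸1)) (FinP.toℕ<n s))
    in ∈-resp-≈ setoid zᵢ≈αₛ (∈-tabulate⁺ setoid i)

  tGen-hPoly : (i : Fin n) → TGen Z (hPoly n k (suc (toℕ i)))
  tGen-hPoly i = tGen-⋆ᴾ Z Q w k homogeneous (mulLinears-constant NS 1ₛ) (hPoly-nonzero i k) vanish
    where
    i′ = toℕ i
    Q : ℕ → Poly n
    Q d = hPoly n d (suc i′)
    homogeneous : HomogeneousFrom 0 Q
    homogeneous d = coeff-fromMonos-homogeneous (monosIn n (suc i′) d) (monosIn-degree n (suc i′) d)
    A≤ = k+i≤n+k∸1 k i′ (FinP.toℕ<n i)
    A = alphas (k + i′) A≤
    NS = List.map -_ A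
    w = mulLinears NS 1ₛ
    vanish : InI Z ((Q ⋆ᴾ w) k)
    vanish z z∈Z = begin
      eval ((Q ⋆ᴾ w) k) z                   ≈⟨ eval-⋆ᴾ Q w k z ⟩
      ((λ d → eval (Q d) z) ⋆ w) k          ≈⟨ ⋆-congˡ w (λ d → eval-hPoly n (suc i′) d z) k ⟩
      (divLinears R 1ₛ ⋆ mulLinears NS 1ₛ) k ≈⟨ ⋆-mulLinears (divLinears R 1ₛ) NS 1ₛ k ⟩
      mulLinears NS (divLinears R 1ₛ ⋆ 1ₛ) k ≈⟨ mulLinears-congʳ NS (⋆-identityʳ (divLinears R 1ₛ)) k ⟩
      mulLinears NS (divLinears R 1ₛ) k      ≈⟨ mulLinears-divLinears-vanish NS R R-distinct R⊆NS k len< ⟩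
      0#                                     ∎
      where
      Zᵢ = take (suc i′) (coordinates z)
      R = List.map -_ Zᵢ
      R-distinct : AllPairs _≉_ R
      R-distinct = AllPairsP.map⁺ (AllPairs.map (_∘ -‿injective)
                     (AllPairsP.take⁺ (suc i′) (coordinates-distinct z z∈Z)))
      R⊆NS : All (_∈ NS) R
      R⊆NS = AllP.map⁺ (All.map (∈-map⁺ setoid setoid -‿cong) (prefix⊆alphas z z∈Z i′ (FinP.toℕ<n i)))
      len< : length NS < k + length R
      len< = ≡.subst₂ _<_
        (≡.sym (≡.trans (ListP.length-map -_ A) (length-alphas (k + i′) A≤)))
        (≡.cong (k +_) (≡.sym (≡.trans (ListP.length-map -_ Zᵢ) (length-take-≤ (suc i′) (coordinates z)
          (≡.subst (suc i′ ≤_) (≡.sym (length-coordinates z)) (FinP.toℕ<n i))))))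
        (ℕP.+-monoʳ-< k (ℕP.n<1+n i′))

  tGen-ePoly : (j : Fin k) → TGen Z (ePoly n (n ∸ toℕ j))
  tGen-ePoly j = tGen-⋆ᴾ Z (ePoly n) w D homogeneous (divLinears-constant A 1ₛ)
                   (ePoly-nonzero (ℕP.m∸n≤m n (toℕ j))) vanish
    where
    D = n ∸ toℕ j
    homogeneous : HomogeneousFrom 0 (ePoly n)
    homogeneous d = coeff-fromMonos-homogeneous (sqfree n d) (sqfree-degree n d)
    A = alphas k k≤n+k∸1
    w = divLinears A 1ₛ
    vanish : InI Z ((ePoly n ⋆ᴾ w) D)
    vanish z z∈Z = begin
      eval ((ePoly n ⋆ᴾ w) D) z                 ≈⟨ eval-⋆ᴾ (ePoly n) w D z ⟩
      ((λ d → eval (ePoly n d) z) ⋆ w) D        ≈⟨ ⋆-congˡ w (λ d → eval-ePoly n d z) D ⟩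
      (mulLinears Zs 1ₛ ⋆ divLinears A 1ₛ) D     ≈⟨ ⋆-divLinears (mulLinears Zs 1ₛ) A 1ₛ D ⟩
      divLinears A (mulLinears Zs 1ₛ ⋆ 1ₛ) D     ≈⟨ divLinears-congʳ A (⋆-identityʳ (mulLinears Zs 1ₛ)) D ⟩
      divLinears A (mulLinears Zs 1ₛ) D          ≈⟨ divLinears-mulLinears-comm A Zs 1ₛ D ⟩
      mulLinears Zs (divLinears A 1ₛ) D          ≈⟨ mulLinears-divLinears-vanish Zs A (alphas-distinct k k≤n+k∸1)
                                                      (alphas⊆coordinates z z∈Z) D len< ⟩
      0#                                         ∎
      where
      Zs = coordinates z
      len< : length Zs < D + length A
      len< = ≡.subst₂ _<_
        (≡.trans (ℕP.m∸n+n≡m (ℕP.<⇒≤ (ℕP.<-≤-trans (FinP.toℕ<n j) k≤n))) (≡.sym (length-coordinates z)))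
        (≡.cong (D +_) (≡.sym (length-alphas k k≤n+k∸1)))
        (ℕP.+-monoʳ-< D (FinP.toℕ<n j))

  tGen-GenJ : ∀ g → GenJ n k g → TGen Z g
  tGen-GenJ _ (inj₁ (i , ≡.refl)) = tGen-hPoly i
  tGen-GenJ _ (inj₂ (j , ≡.refl)) = tGen-ePoly j

lemma3p3 : ∀ {c ℓ} (F : Field c ℓ) (n k : ℕ) → 1 ≤ k → k ≤ n →
    (α : Fin (n + k ∸ 1) → Field.Carrier F) →
    (∀ j j′ → ¬ (j ≡ j′) → ¬ (Field._≈_ F (α j) (α j′))) →
    ∀ p → PolyDefs.InIdeal F (PolyDefs.GenJ F n k) p →
      PolyDefs.InT F (PolyDefs.Zset F n k α) p
lemma3p3 F n k 1≤k k≤n α α-injective =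
  Polynomials.InIdeal-mono F (GeneratorsOfJ.tGen-GenJ F n k 1≤k k≤n α α-injective)
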